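{- Let $p$ be a prime with $p \equiv 3 \pmod 4$ and let $\varepsilon \in \{1, -1\}$. A pair $(X, Y)$ with $X, Y \in M_2(\mathbb{Z})$ satisfies $X^2 + Y^2 = \varepsilon p I$ if and only if it has one of the following forms: (i) $X = \begin{pmatrix} t_1 & t_2 \\ t_3 & -t_1 \end{pmatrix}$, $Y = \begin{pmatrix} s_1 & s_2 \\ s_3 & -s_1 \end{pmatrix}$ with $t_1, t_2, t_3, s_1, s_2, s_3 \in \mathbb{Z}$ and $t_1^2 + t_2 t_3 + s_1^2 + s_2 s_3 = \varepsilon p$; (ii) $X = t_1 I$, $Y = \begin{pmatrix} t_4 & t_2 \\ t_3 & -t_4 \end{pmatrix}$ with $t_1, t_2, t_3, t_4 \in \mathbb{Z}$ and $t_1^2 + t_4^2 + t_2 t_3 = \varepsilon p$; (iii) $X = \begin{pmatrix} t_1 & t_2 \\ t_3 & -t_1 \end{pmatrix}$, $Y = t_4 I$ with $t_1, t_2, t_3, t_4 \in \mathbb{Z}$ and $t_1^2 + t_4^2 + t_2 t_3 = \varepsilon p$; (iv) $X = \begin{pmatrix} t_1 & t_2 \\ t_3 & t_4 \end{pmatrix}$, $Y = \begin{pmatrix} t_4 & -t_2 \\ -t_3 & t_1 \end{pmatrix}$ with $t_1, t_2, t_3, t_4 \in \mathbb{Z}$ and $t_1^2 + t_4^2 + 2 t_2 t_3 = \varepsilon p$; (v) $X = \begin{pmatrix} t_1 & t_2 \\ t_3 & -t_4 \end{pmatrix}$, $Y = \begin{pmatrix} t_4 & t_2 \\ t_3 &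 -t_1 \end{pmatrix}$ with $t_1, t_2, t_3, t_4 \in \mathbb{Z}$ and $t_1^2 + t_4^2 + 2 t_2 t_3 = \varepsilon p$.
   Context: $M_2(\mathbb{Z})$ denotes the ring of $2\times 2$ matrices with integer entries; $I$ is the $2\times 2$ identity matrix. -}

module Defs where

open import Data.Integer using (ℤ; _+_; _*_; -_; +_)
open import Data.Product using (∃-syntax; _×_)
open import Data.Sum using (_⊎_)
open import Relation.Binary.PropositionalEquality using (_≡_)

record M₂ : Set where
  constructor mat
  field
    a b c d : ℤ
open M₂ public

infixl 6 _⊕_
infixl 7 _⊗_

_⊕_ : M₂ → M₂ → M₂
mat a₁ b₁ c₁ d₁ ⊕ mat a₂ b₂ c₂ d₂ = mat (a₁ + a₂) (b₁ + b₂) (c₁ + c₂) (d₁ + d₂)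

_⊗_ : M₂ → M₂ → M₂
mat a₁ b₁ c₁ d₁ ⊗ mat a₂ b₂ c₂ d₂ =
  mat (a₁ * a₂ + b₁ * c₂) (a₁ * b₂ + b₁ * d₂)
      (c₁ * a₂ + d₁ * c₂) (c₁ * b₂ + d₁ * d₂)

scal : ℤ → M₂
scal k = mat k (+ 0) (+ 0) k

sq : ℤ → ℤ
sq x = x * x

Form : ℤ → M₂ → M₂ → Set
Form e X Y =
    (∃[ t₁ ] ∃[ t₂ ] ∃[ t₃ ] ∃[ s₁ ] ∃[ s₂ ] ∃[ s₃ ]
       X ≡ mat t₁ t₂ t₃ (- t₁) × Y ≡ mat s₁ s₂ s₃ (- s₁) ×
       sq t₁ + t₂ * t₃ + sq s₁ + s₂ * s₃ ≡ e)
  ⊎ (∃[ t₁ ] ∃[ t₂ ] ∃[ t₃ ] ∃[ t₄ ]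
       X ≡ scal t₁ × Y ≡ mat t₄ t₂ t₃ (- t₄) ×
       sq t₁ + sq t₄ + t₂ * t₃ ≡ e)
  ⊎ (∃[ t₁ ] ∃[ t₂ ] ∃[ t₃ ] ∃[ t₄ ]
       X ≡ mat t₁ t₂ t₃ (- t₁) × Y ≡ scal t₄ ×
       sq t₁ + sq t₄ + t₂ * t₃ ≡ e)
  ⊎ (∃[ t₁ ] ∃[ t₂ ] ∃[ t₃ ] ∃[ t₄ ]
       X ≡ mat t₁ t₂ t₃ t₄ × Y ≡ mat t₄ (- t₂) (- t₃) t₁ ×
       sq t₁ + sq t₄ + + 2 * t₂ * t₃ ≡ e)
  ⊎ (∃[ t₁ ] ∃[ t₂ ] ∃[ t₃ ] ∃[ t₄ ]
       X ≡ mat t₁ t₂ t₃ (- t₄) × Y ≡ mat t₄ t₂ t₃ (- t₁) ×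
       sq t₁ + sq t₄ + + 2 * t₂ * t₃ ≡ e)

-- Write X = (a b ; c d), Y = (e f ; g h) and let U = a + d, V = e + h be the traces. Comparing entries,
-- X² + Y² = P·I says that (a - d, e - h), (b, f) and (c, g) are orthogonal to (U, V), and that
-- U² + V² + (a - d)² + (e - h)² + 4(bc + fg) = 4P.
-- If U or V vanishes, orthogonality alone gives forms (i)-(iii). Otherwise write (U, V) = G·(u, v) with u, v
-- coprime: every vector orthogonal to (u, v) is a multiple of (v, -u), so u² + v² divides 4P = ±4p. Modulo 8 a
-- sum of two squares, not both even, is 1, 2 or 5, whereas p, 2p and 4p are 3, 4, 6 or 7; so u² + v² is prime
-- to p, divides 4, and |u| = |v| = 1. Then U = ±V, which gives forms (iv) and (v).

module Submission where

open import Defs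
open import Data.Nat using (ℕ; _%_)
open import Data.Nat.Primality using (Prime)
open import Data.Sum using (_⊎_)
open import Function.Bundles using (_⇔_)
open import Relation.Binary.PropositionalEquality using (_≡_)

module SumsOfTwoSquares where

  open import Function using (_∘_)
  open import Data.Fin using (Fin; toℕ)
  open import Data.Fin.Properties using (all?; toℕ-fromℕ<)
  open import Data.Nat
  open import Data.Nat.Coprimality using (Coprime; coprime-divisor)
  open import Data.Nat.Divisibility
  open import Data.Nat.DivMod
  open import Data.Nat.Primality using (Prime; prime⇒irreducible; prime⇒nonZero)
  open import Data.Nat.Properties
  open import Data.Product using (_×_; _,_)
  open import Data.Sum using (_⊎_; inj₁; inj₂)
  open import Relation.Nullary using (¬_; yes; no; contradiction)
  open import Relation.Nullary.Decidable using (toWitness; ¬?; _×-dec_; _⊎-dec_; _→-dec_)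
  open import Relation.Binary.PropositionalEquality
  open import Relation.Unary using (Decidable)

  ∀-residues : ∀ n .{{_ : NonZero n}} (P : ℕ → ℕ → Set) → (∀ (r s : Fin n) → P (toℕ r) (toℕ s)) →
               ∀ x y → P (x % n) (y % n)
  ∀-residues n P P-residues x y =
    subst₂ P (toℕ-fromℕ< (m%n<n x n)) (toℕ-fromℕ< (m%n<n y n)) (P-residues (x mod n) (y mod n))

  PrimitiveSumOfSquaresMod8 : ℕ → Set
  PrimitiveSumOfSquaresMod8 r = r ≡ 1 ⊎ r ≡ 2 ⊎ r ≡ 5

  primitiveSumOfSquaresMod8? : Decidable PrimitiveSumOfSquaresMod8
  primitiveSumOfSquaresMod8? r = r ≟ 1 ⊎-dec r ≟ 2 ⊎-dec r ≟ 5

  EvenOrPrimitiveMod8 : ℕ → ℕ → Set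
  EvenOrPrimitiveMod8 r s = (2 ∣ r × 2 ∣ s) ⊎ PrimitiveSumOfSquaresMod8 ((r * r + s * s) % 8)

  NonPrimitiveMultipleMod8 : ℕ → ℕ → Set
  NonPrimitiveMultipleMod8 k t = k ∣ 4 → t % 4 ≡ 3 → ¬ PrimitiveSumOfSquaresMod8 ((k * t) % 8)

  sum-of-squares-residues : ∀ (r s : Fin 8) → EvenOrPrimitiveMod8 (toℕ r) (toℕ s)
  sum-of-squares-residues = toWitness {a? = all? λ r → all? λ s →
    (2 ∣? toℕ r ×-dec 2 ∣? toℕ s) ⊎-dec primitiveSumOfSquaresMod8? ((toℕ r * toℕ r + toℕ s * toℕ s) % 8)} _

  multiple-of-p-residues : ∀ (k t : Fin 8) → NonPrimitiveMultipleMod8 (toℕ k) (toℕ t)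
  multiple-of-p-residues = toWitness {a? = all? λ k → all? λ t →
    toℕ k ∣? 4 →-dec (toℕ t % 4 ≟ 3 →-dec ¬? (primitiveSumOfSquaresMod8? ((toℕ k * toℕ t) % 8)))} _

  sum-of-squares-% : ∀ x y n .{{_ : NonZero n}} →
    (x * x + y * y) % n ≡ ((x % n) * (x % n) + (y % n) * (y % n)) % n
  sum-of-squares-% x y n = begin
    (x * x + y * y) % n
      ≡⟨ %-distribˡ-+ (x * x) (y * y) n ⟩
    ((x * x) % n + (y * y) % n) % n
      ≡⟨ cong₂ (λ s t → (s + t) % n) (%-distribˡ-* x x n) (%-distribˡ-* y y n) ⟩
    ((x % n) * (x % n) % n + (y % n) * (y % n) % n) % n
      ≡⟨ %-distribˡ-+ ((x % n) * (x % n)) ((y % n) * (y % n)) n ⟨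
    ((x % n) * (x % n) + (y % n) * (y % n)) % n ∎
    where open ≡-Reasoning

  sum-of-squares-mod8 : ∀ x y → ¬ (2 ∣ x × 2 ∣ y) → PrimitiveSumOfSquaresMod8 ((x * x + y * y) % 8)
  sum-of-squares-mod8 x y not-both-even = subst PrimitiveSumOfSquaresMod8 (sym (sum-of-squares-% x y 8))
    (residue-case (∀-residues 8 EvenOrPrimitiveMod8 sum-of-squares-residues x y))
    where
    residue-case : EvenOrPrimitiveMod8 (x % 8) (y % 8) →
                   PrimitiveSumOfSquaresMod8 ((x % 8 * (x % 8) + y % 8 * (y % 8)) % 8)
    residue-case (inj₁ (2∣x%8 , 2∣y%8)) =
      contradiction (∣n∣m%n⇒∣m (divides 4 refl) 2∣x%8 , ∣n∣m%n⇒∣m (divides 4 refl) 2∣y%8) not-both-even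
    residue-case (inj₂ residue) = residue

  multiple-of-p-mod8 : ∀ {k p} → k ∣ 4 → p % 4 ≡ 3 → ¬ PrimitiveSumOfSquaresMod8 ((k * p) % 8)
  multiple-of-p-mod8 {k} {p} k∣4 p%4≡3 = subst (¬_ ∘ PrimitiveSumOfSquaresMod8) (sym (%-distribˡ-* k p 8))
    (∀-residues 8 NonPrimitiveMultipleMod8 multiple-of-p-residues k p k%8∣4 p%8%4≡3)
    where
    k%8∣4 : k % 8 ∣ 4
    k%8∣4 = subst (_∣ 4) (sym (m≤n⇒m%n≡m (≤-trans (∣⇒≤ k∣4) (m≤m+n 4 3)))) k∣4
    p%8%4≡3 : p % 8 % 4 ≡ 3
    p%8%4≡3 = trans (m∣n⇒o%n%m≡o%m 4 8 p (divides 2 refl)) p%4≡3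

  4≤[2+n]² : ∀ n → 4 ≤ (2 + n) * (2 + n)
  4≤[2+n]² n = *-mono-≤ {2} {2 + n} {2} {2 + n} (m≤m+n 2 n) (m≤m+n 2 n)

  squares-sum≤4⇒≡ : ∀ {x y} → x ≢ 0 → y ≢ 0 → x * x + y * y ≤ 4 → x ≡ y
  squares-sum≤4⇒≡ {0}         x≢0 _   _ = contradiction refl x≢0
  squares-sum≤4⇒≡ {_} {0}     _   y≢0 _ = contradiction refl y≢0
  squares-sum≤4⇒≡ {1} {1}     _   _   _ = refl
  squares-sum≤4⇒≡ {1} {2+ y}  _   _   sum≤4 = contradiction sum≤4 (<⇒≱ (+-monoʳ-≤ 1 (4≤[2+n]² y)))
  squares-sum≤4⇒≡ {2+ x} {suc y} _ _  sum≤4 = contradiction sum≤4 (<⇒≱ (+-mono-≤ (4≤[2+n]² x) (s≤s z≤n)))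

  coprime-squares-sum∣4p⇒≡ : ∀ {p x y} → Prime p → p % 4 ≡ 3 → Coprime x y → x ≢ 0 → y ≢ 0 →
    x * x + y * y ∣ 4 * p → x ≡ y
  coprime-squares-sum∣4p⇒≡ {p} {x} {y} p-prime p%4≡3 coprime x≢0 y≢0 N∣4p with p ∣? x * x + y * y
  ... | yes (divides k N≡kp) = contradiction
    (subst PrimitiveSumOfSquaresMod8 (cong (_% 8) N≡kp) (sum-of-squares-mod8 x y not-both-even))
    (multiple-of-p-mod8 {k} {p} (*-cancelʳ-∣ p {{prime⇒nonZero p-prime}} (subst (_∣ 4 * p) N≡kp N∣4p)) p%4≡3)
    where
    not-both-even : ¬ (2 ∣ x × 2 ∣ y)
    not-both-even 2∣x,y with () ← coprime 2∣x,y
  ... | no p∤N =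
    squares-sum≤4⇒≡ x≢0 y≢0 (∣⇒≤ (coprime-divisor N⊥p (subst (x * x + y * y ∣_) (*-comm 4 p) N∣4p)))
    where
    N⊥p : Coprime (x * x + y * y) p
    N⊥p (d∣N , d∣p) with prime⇒irreducible p-prime d∣p
    ... | inj₁ d≡1 = d≡1
    ... | inj₂ refl = contradiction d∣N p∤N

-- Opened only here: inside SumsOfTwoSquares these operators would clash with those of Data.Nat.
open import Data.Integer using (ℤ; +_; -_; _*_; _+_; _-_; 0ℤ; ∣_∣; -[1+_]; +[1+_])
open import Data.Integer.Properties
open import Algebra.Properties.AbelianGroup +-0-abelianGroup using (inverseˡ-unique; inverseʳ-unique; ∙-cancelˡ)
open import Data.Integer.Coprimality using (Coprime; coprime-divisor)
open import Data.Integer.Divisibility.Signed using (_∣_; module _∣_; divides; ∣ᵤ⇒∣; ∣⇒∣ᵤ; ∣n⇒∣m*n; ∣m∣n⇒∣m+n)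
open import Data.Integer.Tactic.RingSolver using (solve-∀)
import Data.Nat as ℕ
import Data.Nat.Coprimality as ℕ
import Data.Nat.Divisibility as ℕ
import Data.Nat.Properties as ℕ
open import Data.Nat.GCD using (gcd; gcd-GCD; GCD; GCD-*; gcd[m,n]≢0)
open import Data.Product using (_×_; _,_; ∃-syntax; swap)
open import Data.Sum using (inj₁; inj₂; [_,_]′)
import Data.Sum as Sum
open import Function using (_∘_)
open import Function.Bundles using (mk⇔)
open import Relation.Nullary using (Dec; yes; no; contradiction)
open import Relation.Binary.PropositionalEquality
open SumsOfTwoSquares using (coprime-squares-sum∣4p⇒≡)

infixl 7 _·_
infix 4 _⊥_

_·_ : ℤ × ℤ → ℤ × ℤ → ℤ
(x , y) · (u , v) = x * u + y * v

-- A record rather than an equation: Agda cannot infer the vectors back from the unfolded integer products.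
record _⊥_ (r w : ℤ × ℤ) : Set where
  constructor orthogonal
  field dot≡0 : r · w ≡ 0ℤ

⊥-swap : ∀ {r w} → r ⊥ w → swap r ⊥ swap w
⊥-swap {x , y} {u , v} (orthogonal xu+yv≡0) = orthogonal (trans (+-comm (y * v) (x * u)) xu+yv≡0)

x*u≡0⇒x≡0 : ∀ {x u} → u ≢ 0ℤ → x * u ≡ 0ℤ → x ≡ 0ℤ
x*u≡0⇒x≡0 {x} u≢0 xu≡0 with i*j≡0⇒i≡0∨j≡0 x xu≡0
... | inj₁ x≡0 = x≡0
... | inj₂ u≡0 = contradiction u≡0 u≢0

⊥[u,0]⇒x≡0 : ∀ {x y u v} → u ≢ 0ℤ → v ≡ 0ℤ → (x , y) ⊥ (u , v) → x ≡ 0ℤ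
⊥[u,0]⇒x≡0 {x} {y} {u} u≢0 refl (orthogonal xu+y0≡0) = x*u≡0⇒x≡0 u≢0 (trans (sym (lemma x y u)) xu+y0≡0)
  where
  lemma : ∀ x y u → x * u + y * 0ℤ ≡ x * u
  lemma = solve-∀

⊥[u,u]⇒y≡-x : ∀ {x y u v} → u ≢ 0ℤ → u ≡ v → (x , y) ⊥ (u , v) → y ≡ - x
⊥[u,u]⇒y≡-x {x} {y} {u} u≢0 refl (orthogonal xu+yu≡0) =
  inverseʳ-unique x y (x*u≡0⇒x≡0 u≢0 (trans (lemma x y u) xu+yu≡0))
  where
  lemma : ∀ x y u → (x + y) * u ≡ x * u + y * u
  lemma = solve-∀

⊥[u,-u]⇒y≡x : ∀ {x y u v} → u ≢ 0ℤ → u ≡ - v → (x , y) ⊥ (u , v) → y ≡ x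
⊥[u,-u]⇒y≡x {x} {y} {u} {v} u≢0 refl (orthogonal x[-v]+yv≡0) =
  sym (i-j≡0⇒i≡j x y (x*u≡0⇒x≡0 u≢0 (trans (lemma x y v) x[-v]+yv≡0)))
  where
  lemma : ∀ x y v → (x - y) * - v ≡ x * - v + y * v
  lemma = solve-∀

⊥-coprime⇒multiple : ∀ {x y u v} → Coprime u v → v ≢ 0ℤ → (x , y) ⊥ (u , v) →
  ∃[ z ] x ≡ z * v × y ≡ - (z * u)
⊥-coprime⇒multiple {x} {y} {u} {v} coprime v≢0 (orthogonal xu+yv≡0) =
  z , x≡zv , inverseʳ-unique (z * u) y (x*u≡0⇒x≡0 v≢0 (begin
    (z * u + y) * v     ≡⟨ lemma z u y v ⟩
    (z * v) * u + y * v ≡⟨ cong (λ w → w * u + y * v) x≡zv ⟨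
    x * u + y * v       ≡⟨ xu+yv≡0 ⟩
    0ℤ                  ∎))
  where
  open ≡-Reasoning
  ux≡-yv : u * x ≡ - y * v
  ux≡-yv = trans (*-comm u x) (trans (inverseˡ-unique (x * u) (y * v) xu+yv≡0) (neg-distribˡ-* y v))
  open _∣_ (∣ᵤ⇒∣ {v} {x} (coprime-divisor v u x (ℕ.sym coprime) (∣⇒∣ᵤ (divides (- y) ux≡-yv))))
    renaming (quotient to z; equality to x≡zv)
  lemma : ∀ z u y v → (z * u + y) * v ≡ (z * v) * u + y * v
  lemma = solve-∀

⊥∧⊥⇒∣· : ∀ {r s u v} → Coprime u v → v ≢ 0ℤ → r ⊥ (u , v) → s ⊥ (u , v) → (u , v) · (u , v) ∣ r · s
⊥∧⊥⇒∣· {x , y} {x′ , y′} {u} {v} coprime v≢0 r⊥w s⊥w =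
  let z  , x≡zv   , y≡-zu   = ⊥-coprime⇒multiple coprime v≢0 r⊥w
      z′ , x′≡z′v , y′≡-z′u = ⊥-coprime⇒multiple coprime v≢0 s⊥w
  in divides (z * z′) (begin
    x * x′ + y * y′                            ≡⟨ cong₂ _+_ (cong₂ _*_ x≡zv x′≡z′v) (cong₂ _*_ y≡-zu y′≡-z′u) ⟩
    z * v * (z′ * v) + - (z * u) * - (z′ * u)  ≡⟨ lemma z z′ u v ⟩
    z * z′ * (u * u + v * v)                   ∎)
  where
  open ≡-Reasoning
  lemma : ∀ z z′ u v → z * v * (z′ * v) + - (z * u) * - (z′ * u) ≡ z * z′ * (u * u + v * v)
  lemma = solve-∀

⊥-scaled⇒⊥ : ∀ {r u v} G → G ≢ 0ℤ → r ⊥ (u * G , v * G) → r ⊥ (u , v)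
⊥-scaled⇒⊥ {x , y} {u} {v} G G≢0 (orthogonal xuG+yvG≡0) =
  orthogonal (x*u≡0⇒x≡0 G≢0 (trans (lemma x y u v G) xuG+yvG≡0))
  where
  lemma : ∀ x y u v G → (x * u + y * v) * G ≡ x * (u * G) + y * (v * G)
  lemma = solve-∀

primitive-decomposition : ∀ U V → V ≢ 0ℤ →
  ∃[ u ] ∃[ v ] ∃[ G ] U ≡ u * G × V ≡ v * G × Coprime u v × G ≢ 0ℤ
primitive-decomposition U V V≢0 = u , v , + n , U≡un , V≡vn , coprime , n≢0 ∘ +-injective
  where
  n : ℕ
  n = gcd ∣ U ∣ ∣ V ∣
  gcd-is : GCD ∣ U ∣ ∣ V ∣ n
  gcd-is = gcd-GCD ∣ U ∣ ∣ V ∣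
  open _∣_ (∣ᵤ⇒∣ {+ n} {U} (GCD.gcd∣m gcd-is)) renaming (quotient to u; equality to U≡un)
  open _∣_ (∣ᵤ⇒∣ {+ n} {V} (GCD.gcd∣n gcd-is)) renaming (quotient to v; equality to V≡vn)
  n≢0 : n ≢ 0
  n≢0 = gcd[m,n]≢0 ∣ U ∣ ∣ V ∣ (inj₂ λ ∣V∣≡0 → V≢0 (∣i∣≡0⇒i≡0 ∣V∣≡0))
  coprime : Coprime u v
  coprime = ℕ.GCD≡1⇒coprime (GCD-* {{ℕ.≢-nonZero n≢0}} (subst₂ (λ A B → GCD A B (1 ℕ.* n))
    (trans (cong ∣_∣ U≡un) (abs-* u (+ n))) (trans (cong ∣_∣ V≡vn) (abs-* v (+ n)))
    (subst (GCD ∣ U ∣ ∣ V ∣) (sym (ℕ.*-identityˡ n)) gcd-is)))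

∣i∣≡∣j∣⇒i≡±j : ∀ i j → ∣ i ∣ ≡ ∣ j ∣ → i ≡ j ⊎ i ≡ - j
∣i∣≡∣j∣⇒i≡±j (+ _)     (+ _)     refl = inj₁ refl
∣i∣≡∣j∣⇒i≡±j (+ _)     -[1+ _ ]  refl = inj₂ refl
∣i∣≡∣j∣⇒i≡±j -[1+ _ ]  (+ _)     refl = inj₂ refl
∣i∣≡∣j∣⇒i≡±j -[1+ _ ]  -[1+ _ ]  refl = inj₁ refl

i*i≡+∣i∣*∣i∣ : ∀ i → i * i ≡ + (∣ i ∣ ℕ.* ∣ i ∣)
i*i≡+∣i∣*∣i∣ (+ 0)     = refl
i*i≡+∣i∣*∣i∣ +[1+ _ ]  = refl
i*i≡+∣i∣*∣i∣ -[1+ _ ]  = refl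

primitive-norm∣4p⇒≡± : ∀ {p} Q {u v} → Prime p → p % 4 ≡ 3 → ∣ Q ∣ ≡ p →
  Coprime u v → u ≢ 0ℤ → v ≢ 0ℤ → (u , v) · (u , v) ∣ + 4 * Q → u ≡ v ⊎ u ≡ - v
primitive-norm∣4p⇒≡± {p} Q {u} {v} p-prime p%4≡3 ∣Q∣≡p coprime u≢0 v≢0 norm∣4Q =
  ∣i∣≡∣j∣⇒i≡±j u v (coprime-squares-sum∣4p⇒≡ p-prime p%4≡3 coprime (u≢0 ∘ ∣i∣≡0⇒i≡0) (v≢0 ∘ ∣i∣≡0⇒i≡0)
    (subst₂ ℕ._∣_ (cong ∣_∣ (cong₂ _+_ (i*i≡+∣i∣*∣i∣ u) (i*i≡+∣i∣*∣i∣ v)))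
                  (trans (abs-* (+ 4) Q) (cong (4 ℕ.*_) ∣Q∣≡p)) (∣⇒∣ᵤ norm∣4Q)))

same-sum-opposite-difference⇒swap : ∀ a d e h → a + d ≡ e + h → e - h ≡ - (a - d) → e ≡ d × h ≡ a
same-sum-opposite-difference⇒swap a d e h sum difference = e≡d , ∙-cancelˡ d h a (begin
  d + h ≡⟨ cong (_+ h) e≡d ⟨
  e + h ≡⟨ sum ⟨
  a + d ≡⟨ +-comm a d ⟩
  d + a ∎)
  where
  open ≡-Reasoning
  twice-e : ∀ e h → + 2 * e ≡ (e + h) + (e - h)
  twice-e = solve-∀
  twice-d : ∀ a d → (a + d) + - (a - d) ≡ + 2 * d
  twice-d = solve-∀
  e≡d : e ≡ d
  e≡d = *-cancelˡ-≡ (+ 2) e d (begin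
    + 2 * e             ≡⟨ twice-e e h ⟩
    (e + h) + (e - h)   ≡⟨ cong₂ _+_ (sym sum) difference ⟩
    (a + d) + - (a - d) ≡⟨ twice-d a d ⟩
    + 2 * d             ∎)

form-i-intro : ∀ {a b c d e f g h P} → d ≡ - a → h ≡ - e →
  a * a + b * c + (e * e + f * g) ≡ P → Form P (mat a b c d) (mat e f g h)
form-i-intro {a} {b} {c} {_} {e} {f} {g} refl refl entry =
  inj₁ (a , b , c , e , f , g , refl , refl , trans (+-assoc (a * a + b * c) (e * e) (f * g)) entry)

form-ii-intro : ∀ {a b c d e f g h P} → b ≡ 0ℤ → c ≡ 0ℤ → d ≡ a → h ≡ - e →
  a * a + b * c + (e * e + f * g) ≡ P → Form P (mat a b c d) (mat e f g h)
form-ii-intro {a} {_} {_} {_} {e} {f} {g} refl refl refl refl entry =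
  inj₂ (inj₁ (a , f , g , e , refl , refl , trans (lemma a e f g) entry))
  where
  lemma : ∀ a e f g → a * a + e * e + f * g ≡ a * a + 0ℤ * 0ℤ + (e * e + f * g)
  lemma = solve-∀

form-iii-intro : ∀ {a b c d e f g h P} → f ≡ 0ℤ → g ≡ 0ℤ → d ≡ - a → h ≡ e →
  a * a + b * c + (e * e + f * g) ≡ P → Form P (mat a b c d) (mat e f g h)
form-iii-intro {a} {b} {c} {_} {e} refl refl refl refl entry =
  inj₂ (inj₂ (inj₁ (a , b , c , e , refl , refl , trans (lemma a b c e) entry)))
  where
  lemma : ∀ a b c e → a * a + e * e + b * c ≡ a * a + b * c + (e * e + 0ℤ * 0ℤ)
  lemma = solve-∀

form-iv-intro : ∀ {a b c d e f g h P} → e ≡ d → h ≡ a → f ≡ - b → g ≡ - c →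
  a * a + b * c + (e * e + f * g) ≡ P → Form P (mat a b c d) (mat e f g h)
form-iv-intro {a} {b} {c} {d} refl refl refl refl entry =
  inj₂ (inj₂ (inj₂ (inj₁ (a , b , c , d , refl , refl , trans (lemma a b c d) entry))))
  where
  lemma : ∀ a b c d → a * a + d * d + + 2 * b * c ≡ a * a + b * c + (d * d + - b * - c)
  lemma = solve-∀

form-v-intro : ∀ {a b c d e f g h P} → d ≡ - e → h ≡ - a → f ≡ b → g ≡ c →
  a * a + b * c + (e * e + f * g) ≡ P → Form P (mat a b c d) (mat e f g h)
form-v-intro {a} {b} {c} {_} {e} refl refl refl refl entry =
  inj₂ (inj₂ (inj₂ (inj₂ (a , b , c , e , refl , refl , trans (lemma a b c e) entry))))
  where
  lemma : ∀ a b c e → a * a + e * e + + 2 * b * c ≡ a * a + b * c + (e * e + b * c)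
  lemma = solve-∀

module ScalarSumOfSquares {a b c d e f g h P : ℤ}
         (X²+Y²≡P : mat a b c d ⊗ mat a b c d ⊕ mat e f g h ⊗ mat e f g h ≡ scal P) where

  private
    entry₁₁ : a * a + b * c + (e * e + f * g) ≡ P
    entry₁₁ = cong M₂.a X²+Y²≡P

    entry₁₂ : a * b + b * d + (e * f + f * h) ≡ 0ℤ
    entry₁₂ = cong M₂.b X²+Y²≡P

    entry₂₁ : c * a + d * c + (g * e + h * g) ≡ 0ℤ
    entry₂₁ = cong M₂.c X²+Y²≡P

    entry₂₂ : c * b + d * d + (g * f + h * h) ≡ P
    entry₂₂ = cong M₂.d X²+Y²≡P

    open ≡-Reasoning

  diagonal⊥traces : (a - d , e - h) ⊥ (a + d , e + h)
  diagonal⊥traces = orthogonal (begin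
    (a - d) * (a + d) + (e - h) * (e + h)                                 ≡⟨ lemma a b c d e f g h ⟩
    (a * a + b * c + (e * e + f * g)) - (c * b + d * d + (g * f + h * h)) ≡⟨ cong₂ _-_ entry₁₁ entry₂₂ ⟩
    P - P                                                                 ≡⟨ +-inverseʳ P ⟩
    0ℤ                                                                    ∎)
    where
    lemma : ∀ a b c d e f g h → (a - d) * (a + d) + (e - h) * (e + h) ≡
                                (a * a + b * c + (e * e + f * g)) - (c * b + d * d + (g * f + h * h))
    lemma = solve-∀

  upper⊥traces : (b , f) ⊥ (a + d , e + h)
  upper⊥traces = orthogonal (trans (lemma a b d e f h) entry₁₂)
    where
    lemma : ∀ a b d e f h → b * (a + d) + f * (e + h) ≡ a * b + b * d + (e * f + f * h)
    lemma = solve-∀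

  lower⊥traces : (c , g) ⊥ (a + d , e + h)
  lower⊥traces = orthogonal (trans (lemma a c d e g h) entry₂₁)
    where
    lemma : ∀ a c d e g h → c * (a + d) + g * (e + h) ≡ c * a + d * c + (g * e + h * g)
    lemma = solve-∀

  norm-identity :
    (a + d , e + h) · (a + d , e + h) + (a - d , e - h) · (a - d , e - h) + + 4 * ((b , f) · (c , g)) ≡ + 4 * P
  norm-identity = begin
    (a + d , e + h) · (a + d , e + h) + (a - d , e - h) · (a - d , e - h) + + 4 * ((b , f) · (c , g))
      ≡⟨ lemma a b c d e f g h ⟩
    + 2 * (a * a + b * c + (e * e + f * g)) + + 2 * (c * b + d * d + (g * f + h * h))
      ≡⟨ cong₂ (λ x y → + 2 * x + + 2 * y) entry₁₁ entry₂₂ ⟩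
    + 2 * P + + 2 * P
      ≡⟨ twice+twice P ⟩
    + 4 * P ∎
    where
    lemma : ∀ a b c d e f g h →
      (a + d) * (a + d) + (e + h) * (e + h) + ((a - d) * (a - d) + (e - h) * (e - h)) + + 4 * (b * c + f * g)
      ≡ + 2 * (a * a + b * c + (e * e + f * g)) + + 2 * (c * b + d * d + (g * f + h * h))
    lemma = solve-∀
    twice+twice : ∀ P → + 2 * P + + 2 * P ≡ + 4 * P
    twice+twice = solve-∀

  traceless-pair : a + d ≡ 0ℤ → e + h ≡ 0ℤ → Form P (mat a b c d) (mat e f g h)
  traceless-pair trX≡0 trY≡0 = form-i-intro (inverseʳ-unique a d trX≡0) (inverseʳ-unique e h trY≡0) entry₁₁

  scalar-and-traceless : a + d ≢ 0ℤ → e + h ≡ 0ℤ → Form P (mat a b c d) (mat e f g h)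
  scalar-and-traceless trX≢0 trY≡0 = form-ii-intro
    (⊥[u,0]⇒x≡0 trX≢0 trY≡0 upper⊥traces) (⊥[u,0]⇒x≡0 trX≢0 trY≡0 lower⊥traces)
    (sym (i-j≡0⇒i≡j a d (⊥[u,0]⇒x≡0 trX≢0 trY≡0 diagonal⊥traces))) (inverseʳ-unique e h trY≡0) entry₁₁

  traceless-and-scalar : a + d ≡ 0ℤ → e + h ≢ 0ℤ → Form P (mat a b c d) (mat e f g h)
  traceless-and-scalar trX≡0 trY≢0 = form-iii-intro
    (⊥[u,0]⇒x≡0 trY≢0 trX≡0 (⊥-swap upper⊥traces)) (⊥[u,0]⇒x≡0 trY≢0 trX≡0 (⊥-swap lower⊥traces))
    (inverseʳ-unique a d trX≡0) (sym (i-j≡0⇒i≡j e h (⊥[u,0]⇒x≡0 trY≢0 trX≡0 (⊥-swap diagonal⊥traces)))) entry₁₁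

  equal-traces : a + d ≢ 0ℤ → a + d ≡ e + h → Form P (mat a b c d) (mat e f g h)
  equal-traces trX≢0 trX≡trY =
    let e≡d , h≡a = same-sum-opposite-difference⇒swap a d e h trX≡trY (⊥[trX,trY] diagonal⊥traces)
    in form-iv-intro e≡d h≡a (⊥[trX,trY] upper⊥traces) (⊥[trX,trY] lower⊥traces) entry₁₁
    where
    ⊥[trX,trY] : ∀ {x y} → (x , y) ⊥ (a + d , e + h) → y ≡ - x
    ⊥[trX,trY] = ⊥[u,u]⇒y≡-x trX≢0 trX≡trY

  opposite-traces : a + d ≢ 0ℤ → a + d ≡ - (e + h) → Form P (mat a b c d) (mat e f g h)
  opposite-traces trX≢0 trX≡-trY =
    let -e≡d , -h≡a = same-sum-opposite-difference⇒swap a d (- e) (- h) sum difference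
    in form-v-intro (sym -e≡d) (trans (sym (neg-involutive h)) (cong -_ -h≡a))
         (⊥[trX,-trX] upper⊥traces) (⊥[trX,-trX] lower⊥traces) entry₁₁
    where
    ⊥[trX,-trX] : ∀ {x y} → (x , y) ⊥ (a + d , e + h) → y ≡ x
    ⊥[trX,-trX] = ⊥[u,-u]⇒y≡x trX≢0 trX≡-trY
    sum : a + d ≡ - e + - h
    sum = trans trX≡-trY (neg-distrib-+ e h)
    difference : - e - - h ≡ - (a - d)
    difference = trans (sym (neg-distrib-+ e (- h))) (cong -_ (⊥[trX,-trX] diagonal⊥traces))

  traces-equal-up-to-sign : ∀ {p} → Prime p → p % 4 ≡ 3 → ∣ P ∣ ≡ p → a + d ≢ 0ℤ → e + h ≢ 0ℤ →
    a + d ≡ e + h ⊎ a + d ≡ - (e + h)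
  traces-equal-up-to-sign p-prime p%4≡3 ∣P∣≡p trX≢0 trY≢0 =
    from-primitive (primitive-decomposition (a + d) (e + h) trY≢0)
    where
    scaled-norm : ∀ u v G → u * G * (u * G) + v * G * (v * G) ≡ G * G * (u * u + v * v)
    scaled-norm = solve-∀
    from-primitive : ∃[ u ] ∃[ v ] ∃[ G ] a + d ≡ u * G × e + h ≡ v * G × Coprime u v × G ≢ 0ℤ →
                     a + d ≡ e + h ⊎ a + d ≡ - (e + h)
    from-primitive (u , v , G , trX≡uG , trY≡vG , coprime , G≢0) =
      Sum.map (λ u≡v → begin
                  a + d ≡⟨ trX≡uG ⟩ u * G ≡⟨ cong (_* G) u≡v ⟩ v * G ≡⟨ trY≡vG ⟨ e + h ∎)
              (λ u≡-v → begin
                  a + d ≡⟨ trX≡uG ⟩ u * G ≡⟨ cong (_* G) u≡-v ⟩ - v * G ≡⟨ neg-distribˡ-* v G ⟨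
                  - (v * G) ≡⟨ cong -_ trY≡vG ⟨ - (e + h) ∎)
              (primitive-norm∣4p⇒≡± P p-prime p%4≡3 ∣P∣≡p coprime u≢0 v≢0 w·w∣4P)
      where
      u≢0 : u ≢ 0ℤ
      u≢0 u≡0 = trX≢0 (trans trX≡uG (cong (_* G) u≡0))
      v≢0 : v ≢ 0ℤ
      v≢0 v≡0 = trY≢0 (trans trY≡vG (cong (_* G) v≡0))
      traces≡G·w : (a + d , e + h) ≡ (u * G , v * G)
      traces≡G·w = cong₂ _,_ trX≡uG trY≡vG
      ⊥w : ∀ {r} → r ⊥ (a + d , e + h) → r ⊥ (u , v)
      ⊥w {r} r⊥traces = ⊥-scaled⇒⊥ G G≢0 (subst (r ⊥_) traces≡G·w r⊥traces)
      w·w∣traces·traces : (u , v) · (u , v) ∣ (a + d , e + h) · (a + d , e + h)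
      w·w∣traces·traces = divides (G * G) (trans (cong (λ w → w · w) traces≡G·w) (scaled-norm u v G))
      w·w∣4P : (u , v) · (u , v) ∣ + 4 * P
      w·w∣4P = subst ((u , v) · (u , v) ∣_) norm-identity
        (∣m∣n⇒∣m+n (∣m∣n⇒∣m+n w·w∣traces·traces (⊥∧⊥⇒∣· coprime v≢0 (⊥w diagonal⊥traces) (⊥w diagonal⊥traces)))
                   (∣n⇒∣m*n (+ 4) (⊥∧⊥⇒∣· coprime v≢0 (⊥w upper⊥traces) (⊥w lower⊥traces))))

sum-of-squares⇒Form : ∀ {p} P → Prime p → p % 4 ≡ 3 → ∣ P ∣ ≡ p → ∀ X Y → X ⊗ X ⊕ Y ⊗ Y ≡ scal P → Form P X Y
sum-of-squares⇒Form P p-prime p%4≡3 ∣P∣≡p (mat a b c d) (mat e f g h) X²+Y²≡P =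
  by-traces (a + d ≟ 0ℤ) (e + h ≟ 0ℤ)
  where
  open ScalarSumOfSquares {a} {b} {c} {d} {e} {f} {g} {h} {P} X²+Y²≡P
  by-traces : Dec (a + d ≡ 0ℤ) → Dec (e + h ≡ 0ℤ) → Form P (mat a b c d) (mat e f g h)
  by-traces (yes trX≡0) (yes trY≡0) = traceless-pair trX≡0 trY≡0
  by-traces (no trX≢0)  (yes trY≡0) = scalar-and-traceless trX≢0 trY≡0
  by-traces (yes trX≡0) (no trY≢0)  = traceless-and-scalar trX≡0 trY≢0
  by-traces (no trX≢0)  (no trY≢0)  =
    [ equal-traces trX≢0 , opposite-traces trX≢0 ]′ (traces-equal-up-to-sign p-prime p%4≡3 ∣P∣≡p trX≢0 trY≢0)

mat-cong : ∀ {a b c d a′ b′ c′ d′} → a ≡ a′ → b ≡ b′ → c ≡ c′ → d ≡ d′ → mat a b c d ≡ mat a′ b′ c′ d′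
mat-cong refl refl refl refl = refl

traceless² : ∀ t₁ t₂ t₃ → mat t₁ t₂ t₃ (- t₁) ⊗ mat t₁ t₂ t₃ (- t₁) ≡ scal (t₁ * t₁ + t₂ * t₃)
traceless² t₁ t₂ t₃ = mat-cong refl (lemma₁₂ t₁ t₂) (lemma₂₁ t₁ t₃) (lemma₂₂ t₁ t₂ t₃)
  where
  lemma₁₂ : ∀ t₁ t₂ → t₁ * t₂ + t₂ * - t₁ ≡ 0ℤ
  lemma₁₂ = solve-∀
  lemma₂₁ : ∀ t₁ t₃ → t₃ * t₁ + - t₁ * t₃ ≡ 0ℤ
  lemma₂₁ = solve-∀
  lemma₂₂ : ∀ t₁ t₂ t₃ → t₃ * t₂ + - t₁ * - t₁ ≡ t₁ * t₁ + t₂ * t₃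
  lemma₂₂ = solve-∀

scal² : ∀ t → scal t ⊗ scal t ≡ scal (t * t)
scal² t = mat-cong (lemma₁₁ t) (lemma₁₂ t) (lemma₂₁ t) (lemma₂₂ t)
  where
  lemma₁₁ : ∀ t → t * t + 0ℤ * 0ℤ ≡ t * t
  lemma₁₁ = solve-∀
  lemma₁₂ : ∀ t → t * 0ℤ + 0ℤ * t ≡ 0ℤ
  lemma₁₂ = solve-∀
  lemma₂₁ : ∀ t → 0ℤ * t + t * 0ℤ ≡ 0ℤ
  lemma₂₁ = solve-∀
  lemma₂₂ : ∀ t → 0ℤ * 0ℤ + t * t ≡ t * t
  lemma₂₂ = solve-∀

sum-of-squares-iv : ∀ t₁ t₂ t₃ t₄ →
  mat t₁ t₂ t₃ t₄ ⊗ mat t₁ t₂ t₃ t₄ ⊕ mat t₄ (- t₂) (- t₃) t₁ ⊗ mat t₄ (- t₂) (- t₃) t₁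
  ≡ scal (t₁ * t₁ + t₄ * t₄ + + 2 * t₂ * t₃)
sum-of-squares-iv t₁ t₂ t₃ t₄ =
  mat-cong (lemma₁₁ t₁ t₂ t₃ t₄) (lemma₁₂ t₁ t₂ t₄) (lemma₂₁ t₁ t₃ t₄) (lemma₂₂ t₁ t₂ t₃ t₄)
  where
  lemma₁₁ : ∀ t₁ t₂ t₃ t₄ → t₁ * t₁ + t₂ * t₃ + (t₄ * t₄ + - t₂ * - t₃) ≡ t₁ * t₁ + t₄ * t₄ + + 2 * t₂ * t₃
  lemma₁₁ = solve-∀
  lemma₁₂ : ∀ t₁ t₂ t₄ → t₁ * t₂ + t₂ * t₄ + (t₄ * - t₂ + - t₂ * t₁) ≡ 0ℤ
  lemma₁₂ = solve-∀
  lemma₂₁ : ∀ t₁ t₃ t₄ → t₃ * t₁ + t₄ * t₃ + (- t₃ * t₄ + t₁ * - t₃) ≡ 0ℤ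
  lemma₂₁ = solve-∀
  lemma₂₂ : ∀ t₁ t₂ t₃ t₄ → t₃ * t₂ + t₄ * t₄ + (- t₃ * - t₂ + t₁ * t₁) ≡ t₁ * t₁ + t₄ * t₄ + + 2 * t₂ * t₃
  lemma₂₂ = solve-∀

sum-of-squares-v : ∀ t₁ t₂ t₃ t₄ →
  mat t₁ t₂ t₃ (- t₄) ⊗ mat t₁ t₂ t₃ (- t₄) ⊕ mat t₄ t₂ t₃ (- t₁) ⊗ mat t₄ t₂ t₃ (- t₁)
  ≡ scal (t₁ * t₁ + t₄ * t₄ + + 2 * t₂ * t₃)
sum-of-squares-v t₁ t₂ t₃ t₄ =
  mat-cong (lemma₁₁ t₁ t₂ t₃ t₄) (lemma₁₂ t₁ t₂ t₄) (lemma₂₁ t₁ t₃ t₄) (lemma₂₂ t₁ t₂ t₃ t₄)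
  where
  lemma₁₁ : ∀ t₁ t₂ t₃ t₄ → t₁ * t₁ + t₂ * t₃ + (t₄ * t₄ + t₂ * t₃) ≡ t₁ * t₁ + t₄ * t₄ + + 2 * t₂ * t₃
  lemma₁₁ = solve-∀
  lemma₁₂ : ∀ t₁ t₂ t₄ → t₁ * t₂ + t₂ * - t₄ + (t₄ * t₂ + t₂ * - t₁) ≡ 0ℤ
  lemma₁₂ = solve-∀
  lemma₂₁ : ∀ t₁ t₃ t₄ → t₃ * t₁ + - t₄ * t₃ + (t₃ * t₄ + - t₁ * t₃) ≡ 0ℤ
  lemma₂₁ = solve-∀
  lemma₂₂ : ∀ t₁ t₂ t₃ t₄ → t₃ * t₂ + - t₄ * - t₄ + (t₃ * t₂ + - t₁ * - t₁) ≡ t₁ * t₁ + t₄ * t₄ + + 2 * t₂ * t₃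
  lemma₂₂ = solve-∀

Form⇒sum-of-squares : ∀ {P X Y} → Form P X Y → X ⊗ X ⊕ Y ⊗ Y ≡ scal P
Form⇒sum-of-squares (inj₁ (t₁ , t₂ , t₃ , s₁ , s₂ , s₃ , refl , refl , refl)) =
  trans (cong₂ _⊕_ (traceless² t₁ t₂ t₃) (traceless² s₁ s₂ s₃))
        (cong scal (sym (+-assoc (t₁ * t₁ + t₂ * t₃) (s₁ * s₁) (s₂ * s₃))))
Form⇒sum-of-squares (inj₂ (inj₁ (t₁ , t₂ , t₃ , t₄ , refl , refl , refl))) =
  trans (cong₂ _⊕_ (scal² t₁) (traceless² t₄ t₂ t₃)) (cong scal (sym (+-assoc (t₁ * t₁) (t₄ * t₄) (t₂ * t₃))))
Form⇒sum-of-squares (inj₂ (inj₂ (inj₁ (t₁ , t₂ , t₃ , t₄ , refl , refl , refl)))) =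
  trans (cong₂ _⊕_ (traceless² t₁ t₂ t₃) (scal² t₄)) (cong scal (lemma t₁ t₂ t₃ t₄))
  where
  lemma : ∀ t₁ t₂ t₃ t₄ → t₁ * t₁ + t₂ * t₃ + t₄ * t₄ ≡ t₁ * t₁ + t₄ * t₄ + t₂ * t₃
  lemma = solve-∀
Form⇒sum-of-squares (inj₂ (inj₂ (inj₂ (inj₁ (t₁ , t₂ , t₃ , t₄ , refl , refl , refl))))) =
  sum-of-squares-iv t₁ t₂ t₃ t₄
Form⇒sum-of-squares (inj₂ (inj₂ (inj₂ (inj₂ (t₁ , t₂ , t₃ , t₄ , refl , refl , refl))))) =
  sum-of-squares-v t₁ t₂ t₃ t₄

∣±p∣≡p : ∀ {ε} p → ε ≡ + 1 ⊎ ε ≡ - + 1 → ∣ ε * + p ∣ ≡ p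
∣±p∣≡p p (inj₁ refl) = trans (abs-* (+ 1) (+ p)) (ℕ.*-identityˡ p)
∣±p∣≡p p (inj₂ refl) = trans (abs-* (- + 1) (+ p)) (ℕ.*-identityˡ p)

proposition4p1 : (p : ℕ) → Prime p → p % 4 ≡ 3 →
    (ε : ℤ) → (ε ≡ + 1 ⊎ ε ≡ - + 1) →
    (X Y : M₂) →
    ((X ⊗ X ⊕ Y ⊗ Y ≡ scal (ε * + p)) ⇔ Form (ε * + p) X Y)
proposition4p1 p p-prime p%4≡3 ε ε≡±1 X Y =
  mk⇔ (sum-of-squares⇒Form (ε * + p) p-prime p%4≡3 (∣±p∣≡p p ε≡±1) X Y) Form⇒sum-of-squares
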